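{- Let $n\ge 4$ be an integer. If a signed Möbius ladder $ML_n$ is flow-admissible, then it has a nowhere-zero $5$-flow.
   Context: The Möbius ladder $ML_n$ (of order $2n$) is obtained from a cycle $w_1w_2\cdots w_{2n}w_1$ by adding the chords $w_jw_{j+n}$ for $j=1,\dots,n$; a signed Möbius ladder carries a sign $+$ or $-$ on each edge. An orientation of a signed graph splits each edge into two half-edges; a positive edge has one half-edge directed away from and one towards its end-vertex, a negative edge has both half-edges directed towards, or both away from, their end-vertices. A nowhere-zero $k$-flow is an orientation with values from $\{\pm1,\dots,\pm(k-1)\}$ on the edges such that at every vertex the sum of incoming values equals the sum of outgoing values. A signed graph is flow-admissible if it admits a nowhere-zero $k$-flow for some $k$. -}

module Defs where

open import Data.Nat using (ℕ; zero; suc; _<_; _≤_; s≤s)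
open import Data.Nat.Properties using (_<?_)
open import Data.Integer using (ℤ; _+_; ∣_∣) renaming (_≟_ to _≟ℤ_)
open import Data.Fin using (Fin; zero; suc; toℕ; fromℕ<; _↑ˡ_; _↑ʳ_; splitAt) renaming (_≟_ to _≟F_)
open import Data.Sum using (_⊎_; inj₁; inj₂; [_,_])
open import Data.Product using (Σ; _×_; _,_; proj₁; proj₂; ∃)
open import Relation.Binary.PropositionalEquality using (_≡_; _≢_)
open import Relation.Nullary using (yes; no)

-- Finite graphs (multigraphs) with explicit edge ends.
-- Vertices are Fin nV, edges are Fin nE; edge e joins
-- proj₁ (ends e) and proj₂ (ends e) (its two half-edges).

data Sign : Set where
  pos neg : Sign

record SignedGraph : Set where
  field
    nV   : ℕ
    nE   : ℕ
    ends : Fin nE → Fin nV × Fin nV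
    sign : Fin nE → Sign
open SignedGraph public

-- direction of a half-edge relative to its end-vertex
data Dir : Set where
  towards away : Dir

-- orientation of one edge: directions of the half-edge at the first end
-- and of the half-edge at the second end
Compatible : Sign → Dir × Dir → Set
Compatible pos (d₁ , d₂) = d₁ ≢ d₂
Compatible neg (d₁ , d₂) = d₁ ≡ d₂

record Orientation (G : SignedGraph) : Set where
  field
    dir        : Fin (nE G) → Dir × Dir
    compatible : ∀ e → Compatible (sign G e) (dir e)
open Orientation public

sumFin : ∀ {m} → (Fin m → ℤ) → ℤ
sumFin {zero}  f = Data.Integer.0ℤ
sumFin {suc m} f = f zero + sumFin (λ i → f (suc i))

halfVal : ∀ {k} → Fin k → Fin k → Dir → Dir → ℤ → ℤ
halfVal u v d want x with u ≟F v
... | no _ = Data.Integer.0ℤ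
... | yes _ with d | want
...   | towards | towards = x
...   | away    | away    = x
...   | _       | _       = Data.Integer.0ℤ

dirSum : (G : SignedGraph) → Orientation G → (Fin (nE G) → ℤ) → Fin (nV G) → Dir → ℤ
dirSum G o f v want =
  sumFin (λ e → halfVal (proj₁ (ends G e)) v (proj₁ (dir o e)) want (f e)
              + halfVal (proj₂ (ends G e)) v (proj₂ (dir o e)) want (f e))

record NZFlow (k : ℕ) (G : SignedGraph) : Set where
  field
    orient   : Orientation G
    value    : Fin (nE G) → ℤ
    nonzero  : ∀ e → 1 ≤ ∣ value e ∣
    bounded  : ∀ e → ∣ value e ∣ < k
    conserve : ∀ v → dirSum G orient value v towards ≡ dirSum G orient value v away

FlowAdmissible : SignedGraph → Set
FlowAdmissible G = ∃ λ k → NZFlow k G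

-- Möbius ladder ML_n: vertices w_1..w_{2n} as Fin (n + n)
-- (w_{j+1} ↦ j), cycle edges j—(j+1 mod 2n) for j : Fin (n + n),
-- chords j—(j+n) for j : Fin n.  Edge set Fin ((n + n) + n).

cycSuc : ∀ {m} → Fin m → Fin m
cycSuc {suc m} i with toℕ i <? m
... | yes p = fromℕ< (s≤s p)
... | no _  = zero

mlEnds : (n : ℕ) → Fin ((n Data.Nat.+ n) Data.Nat.+ n) → Fin (n Data.Nat.+ n) × Fin (n Data.Nat.+ n)
mlEnds n e = [ (λ j → j , cycSuc j) , (λ j → (j ↑ˡ n) , (n ↑ʳ j)) ] (splitAt (n Data.Nat.+ n) e)

MobiusLadder : (n : ℕ) → (Fin ((n Data.Nat.+ n) Data.Nat.+ n) → Sign) → SignedGraph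
MobiusLadder n σ = record
  { nV = n Data.Nat.+ n ; nE = (n Data.Nat.+ n) Data.Nat.+ n ; ends = mlEnds n ; sign = σ }

{-# OPTIONS --safe #-}
module Submission where

-- Switching the vertices of the cycle by the prefix products π of the cycle signs makes every
-- cycle edge positive except the one closing the cycle, whose sign becomes β = π (2n).  Let P j
-- and Q j be the switched values on the cycle edges entering the two ends j and n + j of rung j.
-- Conservation then says exactly that crossing rung j, of switched sign λ j and value a, moves
-- (P, Q) to (P - a, Q + λ j · a), and the two ends of the ladder are glued by
-- (P 0, Q 0) = (β · Q n, P n).  So nowhere-zero k-flows correspond to closed walks of this kind
-- whose coordinates and steps lie in ±{1, …, k - 1}.
--
-- P + Q is invariant under positive rungs and P - Q under negative ones.  Hence there is no
-- closed walk at all if β = + and exactly one rung is negative (P + Q changes by 2a ≠ 0), or if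
-- β = - and the rung word is of the form -*+* or +*-* (some point of the walk has P = 0,
-- resp. Q = 0).  For every other word of length at least 4 a closed walk with values in
-- ±{1, …, 4} exists: the set of points from which (1,1), resp. (1,2), is reachable along a word
-- depends only on a finite summary of the word, and all reachable summaries are enumerated and
-- checked by computation.

open import Defs
open import Data.Bool.Base using (Bool; true; false; T; _∨_)
import Data.Bool.Properties as Bool
open import Data.Empty using (⊥-elim)
open import Data.Fin.Base using (Fin; zero; suc; toℕ; fromℕ<; _↑ˡ_; _↑ʳ_; splitAt)
open import Data.Fin.Properties as Fin using () renaming (_≟_ to _≟ᶠ_)
open import Data.Integer.Base using (ℤ; +_; -[1+_]; 0ℤ; -1ℤ; ∣_∣; _+_; _-_; _*_; -_)
import Data.Integer.Properties as ℤ
open import Data.Integer.Tactic.RingSolver using (solve-∀)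
open import Data.List.Base using (List; []; _∷_; _++_; length; applyUpTo; filter; cartesianProduct; deduplicate)
import Data.List.Properties as List
open import Data.List.Membership.Propositional using (_∈_; find)
open import Data.List.Membership.Propositional.Properties using (∈-filter⁻; ∈-cartesianProduct⁻)
open import Data.List.Relation.Unary.All as All using (All; all?)
open import Data.List.Relation.Unary.Any using (any?)
open import Data.Nat.Base as ℕ using (ℕ; zero; suc; _≤_; _<_; z≤n; s≤s; _⊓_; _≡ᵇ_)
import Data.Nat.Properties as ℕ
open import Data.Product.Base using (_×_; _,_; proj₁; proj₂; ∃-syntax)
import Data.Product.Properties as Product
open import Data.Sum.Base using (_⊎_; inj₁; inj₂; [_,_])
open import Function.Base using (_∘_; _$_)
open import Function.Bundles using (Equivalence)
open import Relation.Binary.Definitions using (DecidableEquality)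
open import Relation.Binary.PropositionalEquality hiding ([_])
open import Relation.Nullary using (Dec; yes; no; ¬_)
open import Relation.Nullary.Decidable using (map′; _×-dec_; _⊎-dec_; _→-dec_; toWitness)

⟦_⟧ : Sign → ℤ
⟦ pos ⟧ = + 1
⟦ neg ⟧ = -1ℤ

infixl 7 _·_
_·_ : Sign → Sign → Sign
pos · s   = s
neg · pos = neg
neg · neg = pos

⟦·⟧ : ∀ s t → ⟦ s · t ⟧ ≡ ⟦ s ⟧ * ⟦ t ⟧
⟦·⟧ pos pos = refl
⟦·⟧ pos neg = refl
⟦·⟧ neg pos = refl
⟦·⟧ neg neg = refl

⟦s⟧*⟦s⟧*i≡i : ∀ s i → ⟦ s ⟧ * (⟦ s ⟧ * i) ≡ i
⟦s⟧*⟦s⟧*i≡i pos i = trans (ℤ.*-identityˡ _) (ℤ.*-identityˡ i)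
⟦s⟧*⟦s⟧*i≡i neg i = trans (ℤ.-1*i≡-i _) (trans (cong -_ (ℤ.-1*i≡-i i)) (ℤ.neg-involutive i))

⟦s·t⟧*⟦t⟧*i≡⟦s⟧*i : ∀ s t i → ⟦ s · t ⟧ * (⟦ t ⟧ * i) ≡ ⟦ s ⟧ * i
⟦s·t⟧*⟦t⟧*i≡⟦s⟧*i s t i = begin
  ⟦ s · t ⟧ * (⟦ t ⟧ * i)       ≡⟨ cong (_* (⟦ t ⟧ * i)) (⟦·⟧ s t) ⟩
  ⟦ s ⟧ * ⟦ t ⟧ * (⟦ t ⟧ * i)   ≡⟨ ℤ.*-assoc ⟦ s ⟧ ⟦ t ⟧ _ ⟩
  ⟦ s ⟧ * (⟦ t ⟧ * (⟦ t ⟧ * i)) ≡⟨ cong (⟦ s ⟧ *_) (⟦s⟧*⟦s⟧*i≡i t i) ⟩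
  ⟦ s ⟧ * i                     ∎
  where open ≡-Reasoning

⟦t⟧*⟦s⟧*i≡⟦s·t⟧*i : ∀ s t i → ⟦ t ⟧ * (⟦ s ⟧ * i) ≡ ⟦ s · t ⟧ * i
⟦t⟧*⟦s⟧*i≡⟦s·t⟧*i s t i = begin
  ⟦ t ⟧ * (⟦ s ⟧ * i)   ≡⟨ ℤ.*-assoc ⟦ t ⟧ ⟦ s ⟧ i ⟨
  ⟦ t ⟧ * ⟦ s ⟧ * i     ≡⟨ cong (_* i) (trans (ℤ.*-comm ⟦ t ⟧ ⟦ s ⟧) (sym (⟦·⟧ s t))) ⟩
  ⟦ s · t ⟧ * i         ∎
  where open ≡-Reasoning

⟦s⟧*i≡0⇒i≡0 : ∀ s {i} → ⟦ s ⟧ * i ≡ 0ℤ → i ≡ 0ℤ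
⟦s⟧*i≡0⇒i≡0 s {i} ⟦s⟧*i≡0 = begin
  i                     ≡⟨ ⟦s⟧*⟦s⟧*i≡i s i ⟨
  ⟦ s ⟧ * (⟦ s ⟧ * i)   ≡⟨ cong (⟦ s ⟧ *_) ⟦s⟧*i≡0 ⟩
  ⟦ s ⟧ * 0ℤ            ≡⟨ ℤ.*-zeroʳ ⟦ s ⟧ ⟩
  0ℤ                    ∎
  where open ≡-Reasoning

∣⟦s⟧*i∣≡∣i∣ : ∀ s i → ∣ ⟦ s ⟧ * i ∣ ≡ ∣ i ∣
∣⟦s⟧*i∣≡∣i∣ pos i = cong ∣_∣ (ℤ.*-identityˡ i)
∣⟦s⟧*i∣≡∣i∣ neg i = trans (cong ∣_∣ (ℤ.-1*i≡-i i)) (ℤ.∣-i∣≡∣i∣ i)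

FlowValue : ℕ → ℤ → Set
FlowValue k x = 1 ≤ ∣ x ∣ × ∣ x ∣ < k

flowValue? : ∀ k x → Dec (FlowValue k x)
flowValue? k x = 1 ℕ.≤? ∣ x ∣ ×-dec ∣ x ∣ ℕ.<? k

flowValue-⟦s⟧* : ∀ {k x} s → FlowValue k x → FlowValue k (⟦ s ⟧ * x)
flowValue-⟦s⟧* {k} {x} s = subst (λ m → 1 ≤ m × m < k) (sym (∣⟦s⟧*i∣≡∣i∣ s x))

flowValue⇒i+i≢0 : ∀ {k} x → FlowValue k x → x + x ≢ 0ℤ
flowValue⇒i+i≢0 (+ zero)  (() , _)
flowValue⇒i+i≢0 (+ suc m) _ ()
flowValue⇒i+i≢0 -[1+ m ]  _ ()

sumFin-cong : ∀ {m} {f g : Fin m → ℤ} → (∀ i → f i ≡ g i) → sumFin f ≡ sumFin g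
sumFin-cong {zero}  f≗g = refl
sumFin-cong {suc m} f≗g = cong₂ _+_ (f≗g zero) (sumFin-cong (f≗g ∘ suc))

sumFin-+ : ∀ {m} (f g : Fin m → ℤ) → sumFin (λ i → f i + g i) ≡ sumFin f + sumFin g
sumFin-+ {zero}  f g = refl
sumFin-+ {suc m} f g = trans (cong (_+_ (f zero + g zero)) (sumFin-+ (f ∘ suc) (g ∘ suc)))
                              (interchange (f zero) (g zero) (sumFin (f ∘ suc)) (sumFin (g ∘ suc)))
  where
  interchange : ∀ a b c d → a + b + (c + d) ≡ a + c + (b + d)
  interchange = solve-∀

sumFin-- : ∀ {m} (f g : Fin m → ℤ) → sumFin f - sumFin g ≡ sumFin (λ i → f i - g i)
sumFin-- {zero}  f g = refl
sumFin-- {suc m} f g = trans (interchange (f zero) (g zero) (sumFin (f ∘ suc)) (sumFin (g ∘ suc)))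
                              (cong (_+_ (f zero - g zero)) (sumFin-- (f ∘ suc) (g ∘ suc)))
  where
  interchange : ∀ a b c d → a + c - (b + d) ≡ a - b + (c - d)
  interchange = solve-∀

sumFin-zero : ∀ {m} (f : Fin m → ℤ) → (∀ i → f i ≡ 0ℤ) → sumFin f ≡ 0ℤ
sumFin-zero {zero}  f f≗0 = refl
sumFin-zero {suc m} f f≗0 = cong₂ _+_ (f≗0 zero) (sumFin-zero (f ∘ suc) (f≗0 ∘ suc))

sumFin-single : ∀ {m} (f : Fin m → ℤ) u → (∀ i → i ≢ u → f i ≡ 0ℤ) → sumFin f ≡ f u
sumFin-single {suc m} f zero    f≗0 =
  trans (cong (_+_ (f zero)) (sumFin-zero (f ∘ suc) (λ i → f≗0 (suc i) λ ())))
        (ℤ.+-identityʳ (f zero))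
sumFin-single {suc m} f (suc u) f≗0 =
  trans (cong (_+ sumFin (f ∘ suc)) (f≗0 zero λ ()))
        (trans (ℤ.+-identityˡ _) (sumFin-single (f ∘ suc) u (λ i i≢u → f≗0 (suc i) (i≢u ∘ Fin.suc-injective))))

sumFin-↑ : ∀ {m k} (f : Fin (m ℕ.+ k) → ℤ) →
           sumFin f ≡ sumFin (λ i → f (i ↑ˡ k)) + sumFin (λ j → f (m ↑ʳ j))
sumFin-↑ {zero}  f = sym (ℤ.+-identityˡ _)
sumFin-↑ {suc m} f = trans (cong (_+_ (f zero)) (sumFin-↑ {m} (f ∘ suc))) (sym (ℤ.+-assoc (f zero) _ _))

inward : Dir → ℤ → ℤ
inward towards x = x
inward away    x = - x

flowValue-inward : ∀ {k x} d → FlowValue k x → FlowValue k (inward d x)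
flowValue-inward towards ok = ok
flowValue-inward {k} {x} away ok = subst (λ m → 1 ≤ m × m < k) (sym (ℤ.∣-i∣≡∣i∣ x)) ok

inward-compatible : ∀ s d₁ d₂ x → Compatible s (d₁ , d₂) → inward d₂ x ≡ - (⟦ s ⟧ * inward d₁ x)
inward-compatible pos towards towards x d₁≢d₂ = ⊥-elim (d₁≢d₂ refl)
inward-compatible pos towards away    x _     = cong -_ (sym (ℤ.*-identityˡ x))
inward-compatible pos away    towards x _     = sym (trans (cong -_ (ℤ.*-identityˡ (- x))) (ℤ.neg-involutive x))
inward-compatible pos away    away    x d₁≢d₂ = ⊥-elim (d₁≢d₂ refl)
inward-compatible neg d       .d      x refl  = sym (trans (cong -_ (ℤ.-1*i≡-i _)) (ℤ.neg-involutive _))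

halfInflow : ∀ {k} → Fin k → Fin k → Dir → ℤ → ℤ
halfInflow u v d x with u ≟ᶠ v
... | yes _ = inward d x
... | no  _ = 0ℤ

halfVal-towards-away : ∀ {k} (u v : Fin k) d x → halfVal u v d towards x - halfVal u v d away x ≡ halfInflow u v d x
halfVal-towards-away u v d x with u ≟ᶠ v
... | no  _ = refl
... | yes _ with d
...   | towards = ℤ.+-identityʳ x
...   | away    = ℤ.+-identityˡ (- x)

sumFin-halfInflow-hit : ∀ {m k} (h : Fin m → Fin k) v (D : Fin m → Dir) (x : Fin m → ℤ) u →
  h u ≡ v → (∀ i → h i ≡ v → i ≡ u) → sumFin (λ i → halfInflow (h i) v (D i) (x i)) ≡ inward (D u) (x u)
sumFin-halfInflow-hit h v D x u refl h⁻¹v≡u = trans (sumFin-single _ u miss) (hit (h u))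
  where
  miss : ∀ i → i ≢ u → halfInflow (h i) (h u) (D i) (x i) ≡ 0ℤ
  miss i i≢u with h i ≟ᶠ h u
  ... | yes hi≡hu = ⊥-elim (i≢u (h⁻¹v≡u i hi≡hu))
  ... | no  _     = refl
  hit : ∀ w → halfInflow w w (D u) (x u) ≡ inward (D u) (x u)
  hit w with w ≟ᶠ w
  ... | yes _   = refl
  ... | no  w≢w = ⊥-elim (w≢w refl)

sumFin-halfInflow-miss : ∀ {m k} (h : Fin m → Fin k) v (D : Fin m → Dir) (x : Fin m → ℤ) →
  (∀ i → h i ≢ v) → sumFin (λ i → halfInflow (h i) v (D i) (x i)) ≡ 0ℤ
sumFin-halfInflow-miss h v D x h≢v = sumFin-zero _ miss
  where
  miss : ∀ i → halfInflow (h i) v (D i) (x i) ≡ 0ℤ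
  miss i with h i ≟ᶠ v
  ... | yes hi≡v = ⊥-elim (h≢v i hi≡v)
  ... | no  _    = refl

module _ (G : SignedGraph) (o : Orientation G) (f : Fin (nE G) → ℤ) where

  private
    d₁ d₂ : Fin (nE G) → Dir
    d₁ e = proj₁ (dir o e)
    d₂ e = proj₂ (dir o e)

  netInflow : Fin (nV G) → ℤ
  netInflow v = dirSum G o f v towards - dirSum G o f v away

  edgeInflow : Fin (nV G) → Fin (nE G) → ℤ
  edgeInflow v e = halfInflow (proj₁ (ends G e)) v (d₁ e) (f e) + halfInflow (proj₂ (ends G e)) v (d₂ e) (f e)

  netInflow-edges : ∀ v → netInflow v ≡ sumFin (edgeInflow v)
  netInflow-edges v = trans (sumFin-- (halves towards) (halves away)) (sumFin-cong λ e →
    trans (interchange (hv₁ towards e) (hv₂ towards e) (hv₁ away e) (hv₂ away e))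
          (cong₂ _+_ (halfVal-towards-away (proj₁ (ends G e)) v (d₁ e) (f e))
                     (halfVal-towards-away (proj₂ (ends G e)) v (d₂ e) (f e))))
    where
    hv₁ hv₂ halves : Dir → Fin (nE G) → ℤ
    hv₁ want e = halfVal (proj₁ (ends G e)) v (d₁ e) want (f e)
    hv₂ want e = halfVal (proj₂ (ends G e)) v (d₂ e) want (f e)
    halves want e = hv₁ want e + hv₂ want e
    interchange : ∀ a b c d → a + b - (c + d) ≡ a - c + (b - d)
    interchange = solve-∀

  sumFin-edgeInflow : ∀ {m} (E : Fin m → Fin (nE G)) (u w : Fin m → Fin (nV G)) v →
    (∀ i → ends G (E i) ≡ (u i , w i)) →
    sumFin (edgeInflow v ∘ E) ≡ sumFin (λ i → halfInflow (u i) v (d₁ (E i)) (f (E i)))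
                              + sumFin (λ i → halfInflow (w i) v (d₂ (E i)) (f (E i)))
  sumFin-edgeInflow E u w v ends-E =
    trans (sumFin-cong (λ i → cong (λ (x , y) → half₁ x i + half₂ y i) (ends-E i)))
          (sumFin-+ (λ i → half₁ (u i) i) (λ i → half₂ (w i) i))
    where
    half₁ half₂ : Fin (nV G) → Fin _ → ℤ
    half₁ x i = halfInflow x v (d₁ (E i)) (f (E i))
    half₂ y i = halfInflow y v (d₂ (E i)) (f (E i))

cycPred : ℕ → ℕ → ℕ
cycPred M zero    = M
cycPred M (suc k) = k

cycPred< : ∀ M k → k < suc M → cycPred M k < suc M
cycPred< M zero    _     = ℕ.n<1+n M
cycPred< M (suc k) k<1+M = ℕ.<-trans (ℕ.n<1+n k) k<1+M

toℕ-cycSuc : ∀ {M} (i : Fin (suc M)) →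
  toℕ i < M × toℕ (cycSuc i) ≡ suc (toℕ i) ⊎ toℕ i ≡ M × toℕ (cycSuc i) ≡ 0
toℕ-cycSuc {M} i with toℕ i ℕ.<? M
... | yes i<M = inj₁ (i<M , Fin.toℕ-fromℕ< (s≤s i<M))
... | no  i≮M = inj₂ (ℕ.≤-antisym (ℕ.≤-pred (Fin.toℕ<n i)) (ℕ.≮⇒≥ i≮M) , refl)

cycSuc≡⇒toℕ≡cycPred : ∀ {M} (i v : Fin (suc M)) → cycSuc i ≡ v → toℕ i ≡ cycPred M (toℕ v)
cycSuc≡⇒toℕ≡cycPred i _ refl with toℕ-cycSuc i
... | inj₁ (_   , i+1) rewrite i+1 = refl
... | inj₂ (i≡M , i+1) rewrite i+1 = i≡M

cpred : ∀ {M} → Fin (suc M) → Fin (suc M)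
cpred {M} v = fromℕ< (cycPred< M (toℕ v) (Fin.toℕ<n v))

toℕ-cpred : ∀ {M} (v : Fin (suc M)) → toℕ (cpred v) ≡ cycPred M (toℕ v)
toℕ-cpred {M} v = Fin.toℕ-fromℕ< (cycPred< M (toℕ v) (Fin.toℕ<n v))

cycSuc-cpred : ∀ {M} (v : Fin (suc M)) → cycSuc (cpred v) ≡ v
cycSuc-cpred {M} v = Fin.toℕ-injective (successor (toℕ v) (toℕ-cpred v) (toℕ-cycSuc (cpred v)) (Fin.toℕ<n v))
  where
  successor : ∀ {c s} k → c ≡ cycPred M k → c < M × s ≡ suc c ⊎ c ≡ M × s ≡ 0 → k < suc M → s ≡ k
  successor zero    c≡M (inj₁ (c<M , _))   _       = ⊥-elim (ℕ.<-irrefl c≡M c<M)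
  successor zero    _   (inj₂ (_ , s≡0))   _       = s≡0
  successor (suc k) c≡k (inj₁ (_ , s≡1+c)) _       = trans s≡1+c (cong suc c≡k)
  successor (suc k) c≡k (inj₂ (c≡M , _))   1+k<1+M = ⊥-elim (ℕ.<-irrefl (trans (sym c≡k) c≡M) (ℕ.≤-pred 1+k<1+M))

cycSuc≡⇒≡cpred : ∀ {M} (i v : Fin (suc M)) → cycSuc i ≡ v → i ≡ cpred v
cycSuc≡⇒≡cpred i v cycSuc-i≡v = Fin.toℕ-injective (trans (cycSuc≡⇒toℕ≡cycPred i v cycSuc-i≡v) (sym (toℕ-cpred v)))

↑ˡ≢↑ʳ : ∀ {m k} (i : Fin m) (j : Fin k) → i ↑ˡ k ≢ m ↑ʳ j
↑ˡ≢↑ʳ {m} {k} i j i↑ˡk≡m↑ʳj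
  with trans (sym (Fin.splitAt-↑ˡ m i k)) (trans (cong (splitAt m) i↑ˡk≡m↑ʳj) (Fin.splitAt-↑ʳ m k j))
... | ()

atℕ : ∀ {m} {A : Set} → A → (Fin m → A) → ℕ → A
atℕ {m} d F k with k ℕ.<? m
... | yes k<m = F (fromℕ< k<m)
... | no  _   = d

atℕ-fromℕ< : ∀ {m} {A : Set} (d : A) (F : Fin m → A) {k} (k<m : k < m) → atℕ d F k ≡ F (fromℕ< k<m)
atℕ-fromℕ< {m} d F {k} k<m with k ℕ.<? m
... | yes k<m′ = cong F (Fin.fromℕ<-cong k k refl k<m′ k<m)
... | no  k≮m  = ⊥-elim (k≮m k<m)

atℕ-toℕ : ∀ {m} {A : Set} (d : A) (F : Fin m → A) i → atℕ d F (toℕ i) ≡ F i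
atℕ-toℕ d F i = trans (atℕ-fromℕ< d F (Fin.toℕ<n i)) (cong F (Fin.fromℕ<-toℕ i (Fin.toℕ<n i)))

-- Ladder walks

Point : Set
Point = ℤ × ℤ

_≟ᴾ_ : DecidableEquality Point
_≟ᴾ_ = Product.≡-dec ℤ._≟_ ℤ._≟_

FlowPoint : ℕ → Point → Set
FlowPoint k (p , q) = FlowValue k p × FlowValue k q

data Step (k : ℕ) (c : Sign) : Point → Point → Set where
  move : ∀ {p q} a → FlowValue k a → Step k c (p , q) (p - a , q + ⟦ c ⟧ * a)

data Walk (k : ℕ) : List Sign → Point → Point → Set where
  stop : ∀ {s} → FlowPoint k s → Walk k [] s s
  step : ∀ {c w s r t} → FlowPoint k s → Step k c s r → Walk k w r t → Walk k (c ∷ w) s t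

twist : Sign → Point → Point
twist β (p , q) = (⟦ β ⟧ * q , p)

p-[p-a]≡a : ∀ p a → p - (p - a) ≡ a
p-[p-a]≡a = solve-∀

step? : ∀ k c s r → Dec (Step k c s r)
step? k c (p , q) (p′ , q′) = map′ to from (flowValue? k (p - p′) ×-dec q′ ℤ.≟ q + ⟦ c ⟧ * (p - p′))
  where
  to : FlowValue k (p - p′) × q′ ≡ q + ⟦ c ⟧ * (p - p′) → Step k c (p , q) (p′ , q′)
  to (ok , refl) = subst (λ x → Step k c (p , q) (x , q + ⟦ c ⟧ * (p - p′))) (p-[p-a]≡a p p′) (move (p - p′) ok)
  from : Step k c (p , q) (p′ , q′) → FlowValue k (p - p′) × q′ ≡ q + ⟦ c ⟧ * (p - p′)
  from (move a ok) rewrite p-[p-a]≡a p a = ok , refl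

step-from-equations : ∀ {k} c {p q p′ q′} a → FlowValue k a →
  p′ - p + a ≡ 0ℤ → q′ - q + - (⟦ c ⟧ * a) ≡ 0ℤ → Step k c (p , q) (p′ , q′)
step-from-equations {k} c {p} {q} {p′} {q′} a ok eq₁ eq₂ =
  subst (Step k c (p , q)) (cong₂ _,_ (sym p′≡) (sym q′≡)) (move a ok)
  where
  x-[y-z]≡x-y+z : ∀ x y z → x - (y - z) ≡ x - y + z
  x-[y-z]≡x-y+z = solve-∀
  x-[y+z]≡x-y-z : ∀ x y z → x - (y + z) ≡ x - y + - z
  x-[y+z]≡x-y-z = solve-∀
  p′≡ : p′ ≡ p - a
  p′≡ = ℤ.i-j≡0⇒i≡j p′ (p - a) (trans (x-[y-z]≡x-y+z p′ p a) eq₁)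
  q′≡ : q′ ≡ q + ⟦ c ⟧ * a
  q′≡ = ℤ.i-j≡0⇒i≡j q′ (q + ⟦ c ⟧ * a) (trans (x-[y+z]≡x-y-z q′ q (⟦ c ⟧ * a)) eq₂)

step-value : ∀ {k c s r} → Step k c s r → FlowValue k (proj₁ s - proj₁ r)
step-value {k} (move {p} a ok) = subst (FlowValue k) (sym (p-[p-a]≡a p a)) ok

step-equation : ∀ {k c s r} → Step k c s r → proj₂ r - proj₂ s + - (⟦ c ⟧ * (proj₁ s - proj₁ r)) ≡ 0ℤ
step-equation {c = c} (move {p} {q} a _) = ring ⟦ c ⟧ p q a
  where
  ring : ∀ c p q a → q + c * a - q + - (c * (p - (p - a))) ≡ 0ℤ
  ring = solve-∀

record IsPath (k : ℕ) (cs : ℕ → Sign) (m : ℕ) (R : ℕ → Point) : Set where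
  field
    valid : ∀ j → j ≤ m → FlowPoint k (R j)
    steps : ∀ j → j < m → Step k (cs j) (R j) (R (suc j))

path⇒walk : ∀ {k} cs m R → IsPath k cs m R → Walk k (applyUpTo cs m) (R 0) (R m)
path⇒walk cs zero    R path = stop (IsPath.valid path 0 z≤n)
path⇒walk cs (suc m) R path = step (valid 0 z≤n) (steps 0 (s≤s z≤n)) (path⇒walk (cs ∘ suc) m (R ∘ suc) tail)
  where
  open IsPath path
  tail : IsPath _ (cs ∘ suc) m (R ∘ suc)
  tail = record { valid = λ j j≤m → valid (suc j) (s≤s j≤m) ; steps = λ j j<m → steps (suc j) (s≤s j<m) }

walk⇒path : ∀ {k} cs m {s t} → Walk k (applyUpTo cs m) s t → ∃[ R ] R 0 ≡ s × R m ≡ t × IsPath k cs m R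
walk⇒path cs zero    {s} (stop s-ok) = (λ _ → s) , refl , refl , record { valid = λ _ _ → s-ok ; steps = λ _ () }
walk⇒path cs (suc m) {s} (step s-ok s→r r⇝t) with walk⇒path (cs ∘ suc) m r⇝t
... | R , R₀ , Rₘ , path = S , refl , Rₘ , record { valid = valid′ ; steps = steps′ }
  where
  open IsPath path
  S : ℕ → Point
  S zero    = s
  S (suc j) = R j
  valid′ : ∀ j → j ≤ suc m → FlowPoint _ (S j)
  valid′ zero    _         = s-ok
  valid′ (suc j) (s≤s j≤m) = valid j j≤m
  steps′ : ∀ j → j < suc m → Step _ (cs j) (S j) (S (suc j))
  steps′ zero    _         = subst (Step _ (cs 0) s) (sym R₀) s→r
  steps′ (suc j) (s≤s j<m) = steps j j<m

-- Obstructed rung words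

allPos allNeg negsThenPoss possThenNegs : List Sign → Bool
allPos []        = true
allPos (pos ∷ w) = allPos w
allPos (neg ∷ w) = false

allNeg []        = true
allNeg (pos ∷ w) = false
allNeg (neg ∷ w) = allNeg w

negsThenPoss []        = true
negsThenPoss (pos ∷ w) = allPos w
negsThenPoss (neg ∷ w) = negsThenPoss w

possThenNegs []        = true
possThenNegs (pos ∷ w) = possThenNegs w
possThenNegs (neg ∷ w) = allNeg w

negCount : List Sign → ℕ
negCount []        = 0
negCount (pos ∷ w) = negCount w
negCount (neg ∷ w) = suc (negCount w)

negCount≡0⇒allPos : ∀ w → negCount w ≡ 0 → T (allPos w)
negCount≡0⇒allPos []        _    = _
negCount≡0⇒allPos (pos ∷ w) none = negCount≡0⇒allPos w none

Obstructed : Sign → List Sign → Bool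
Obstructed pos w = negCount w ≡ᵇ 1
Obstructed neg w = negsThenPoss w ∨ possThenNegs w

plus minus : Point → ℤ
plus  (p , q) = p + q
minus (p , q) = p - q

step-pos-plus : ∀ {k s r} → Step k pos s r → plus r ≡ plus s
step-pos-plus (move {p} {q} a _) = ring p q a
  where
  ring : ∀ p q a → p - a + (q + + 1 * a) ≡ p + q
  ring = solve-∀

step-neg-minus : ∀ {k s r} → Step k neg s r → minus r ≡ minus s
step-neg-minus (move {p} {q} a _) = ring p q a
  where
  ring : ∀ p q a → p - a - (q + -1ℤ * a) ≡ p - q
  ring = solve-∀

step-neg-plus : ∀ {k s r} → Step k neg s r → plus r ≢ plus s
step-neg-plus (move {p} {q} a a-ok) r≡s =
  flowValue⇒i+i≢0 a a-ok (trans (ring p q a) (ℤ.i≡j⇒i-j≡0 (sym r≡s)))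
  where
  ring : ∀ p q a → a + a ≡ p + q - (p - a + (q + -1ℤ * a))
  ring = solve-∀

walk-allPos : ∀ {k w s t} → Walk k w s t → T (allPos w) → plus t ≡ plus s
walk-allPos (stop _)                   _  = refl
walk-allPos (step {c = pos} _ s→r r⇝t) ok = trans (walk-allPos r⇝t ok) (step-pos-plus s→r)

walk-allNeg : ∀ {k w s t} → Walk k w s t → T (allNeg w) → minus t ≡ minus s
walk-allNeg (stop _)                   _  = refl
walk-allNeg (step {c = neg} _ s→r r⇝t) ok = trans (walk-allNeg r⇝t ok) (step-neg-minus s→r)

walk-oneNeg : ∀ {k w s t} → Walk k w s t → negCount w ≡ 1 → plus t ≢ plus s
walk-oneNeg (step {c = pos} _ s→r r⇝t) one t≡s = walk-oneNeg r⇝t one (trans t≡s (sym (step-pos-plus s→r)))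
walk-oneNeg (step {c = neg} {w = w} _ s→r r⇝t) one t≡s =
  step-neg-plus s→r (trans (sym (walk-allPos r⇝t (negCount≡0⇒allPos w (ℕ.suc-injective one)))) t≡s)

walk-negsThenPoss : ∀ {k w s t} → Walk k w s t → T (negsThenPoss w) →
  ∃[ r ] FlowPoint k r × minus r ≡ minus s × plus r ≡ plus t
walk-negsThenPoss {s = s} (stop s-ok) _ = s , s-ok , refl , refl
walk-negsThenPoss {s = s} s⇝t@(step {c = pos} s-ok _ _) ok = s , s-ok , refl , sym (walk-allPos s⇝t ok)
walk-negsThenPoss (step {c = neg} _ s→r r⇝t) ok with walk-negsThenPoss r⇝t ok
... | x , x-ok , x≡r , x≡t = x , x-ok , trans x≡r (step-neg-minus s→r) , x≡t

walk-possThenNegs : ∀ {k w s t} → Walk k w s t → T (possThenNegs w) →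
  ∃[ r ] FlowPoint k r × plus r ≡ plus s × minus r ≡ minus t
walk-possThenNegs {s = s} (stop s-ok) _ = s , s-ok , refl , refl
walk-possThenNegs {s = s} s⇝t@(step {c = neg} s-ok _ _) ok = s , s-ok , refl , sym (walk-allNeg s⇝t ok)
walk-possThenNegs (step {c = pos} _ s→r r⇝t) ok with walk-possThenNegs r⇝t ok
... | x , x-ok , x≡r , x≡t = x , x-ok , trans x≡r (step-pos-plus s→r) , x≡t

closedWalk⇒negCount≢1 : ∀ {k w} t → Walk k w (twist pos t) t → negCount w ≢ 1
closedWalk⇒negCount≢1 (p , q) s⇝t one = walk-oneNeg s⇝t one (ring p q)
  where
  ring : ∀ p q → p + q ≡ + 1 * q + p
  ring = solve-∀

closedWalk⇒¬negsThenPoss : ∀ {k w} t → Walk k w (twist neg t) t → ¬ T (negsThenPoss w)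
closedWalk⇒¬negsThenPoss (p , q) s⇝t ok with walk-negsThenPoss s⇝t ok
... | (x , y) , (x-ok , _) , x-y≡ , x+y≡ =
  flowValue⇒i+i≢0 x x-ok (trans (ring x y p q) (cong₂ _+_ (ℤ.i≡j⇒i-j≡0 x-y≡) (ℤ.i≡j⇒i-j≡0 x+y≡)))
  where
  ring : ∀ x y p q → x + x ≡ (x - y - (-1ℤ * q - p)) + (x + y - (p + q))
  ring = solve-∀

closedWalk⇒¬possThenNegs : ∀ {k w} t → Walk k w (twist neg t) t → ¬ T (possThenNegs w)
closedWalk⇒¬possThenNegs (p , q) s⇝t ok with walk-possThenNegs s⇝t ok
... | (x , y) , (_ , y-ok) , x+y≡ , x-y≡ =
  flowValue⇒i+i≢0 y y-ok (trans (ring x y p q) (cong₂ _-_ (ℤ.i≡j⇒i-j≡0 x+y≡) (ℤ.i≡j⇒i-j≡0 x-y≡)))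
  where
  ring : ∀ x y p q → y + y ≡ (x + y - (-1ℤ * q + p)) - (x - y - (p - q))
  ring = solve-∀

closedWalk⇒¬Obstructed : ∀ {k} β w t → Walk k w (twist β t) t → ¬ T (Obstructed β w)
closedWalk⇒¬Obstructed pos w t s⇝t obstructed = closedWalk⇒negCount≢1 t s⇝t (ℕ.≡ᵇ⇒≡ (negCount w) 1 obstructed)
closedWalk⇒¬Obstructed neg w t s⇝t obstructed =
  [ closedWalk⇒¬negsThenPoss t s⇝t , closedWalk⇒¬possThenNegs t s⇝t ] (Equivalence.to Bool.T-∨ obstructed)

-- A finite certificate for unobstructed rung words

open import Data.List.Membership.DecPropositional _≟ᴾ_ using () renaming (_∈?_ to _∈ᴾ?_)

values₅ : List ℤ
values₅ = + 1 ∷ + 2 ∷ + 3 ∷ + 4 ∷ -[1+ 0 ] ∷ -[1+ 1 ] ∷ -[1+ 2 ] ∷ -[1+ 3 ] ∷ []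

grid : List Point
grid = cartesianProduct values₅ values₅

grid-flowPoint : ∀ {s} → s ∈ grid → FlowPoint 5 s
grid-flowPoint s∈grid with ∈-cartesianProduct⁻ values₅ values₅ s∈grid
... | p∈ , q∈ = All.lookup values₅-ok p∈ , All.lookup values₅-ok q∈
  where
  values₅-ok : All (FlowValue 5) values₅
  values₅-ok = toWitness {a? = all? (flowValue? 5) values₅} _

stepBack : Sign → List Point → List Point
stepBack c R = filter (λ s → any? (step? 5 c s) R) grid

canReach : List Sign → Point → List Point
canReach []      t = filter (_≟ᴾ t) grid
canReach (c ∷ w) t = stepBack c (canReach w t)

canReach-sound : ∀ w {s t} → s ∈ canReach w t → Walk 5 w s t
canReach-sound []      {t = t} s∈ with ∈-filter⁻ (_≟ᴾ t) s∈
... | s∈grid , refl = stop (grid-flowPoint s∈grid)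
canReach-sound (c ∷ w) {t = t} s∈ with ∈-filter⁻ (λ s → any? (step? 5 c s) (canReach w t)) s∈
... | s∈grid , s→R with find s→R
...   | r , r∈ , s→r = step (grid-flowPoint s∈grid) s→r (canReach-sound w r∈)

record Shape : Set where
  constructor shape
  field
    lengthCap negCountCap                           : ℕ
    isAllPos isAllNeg isNegsThenPoss isPossThenNegs : Bool

_≟ˢʰ_ : DecidableEquality Shape
shape l m a b c d ≟ˢʰ shape l′ m′ a′ b′ c′ d′ =
  map′ (λ { (refl , refl , refl , refl , refl , refl) → refl })
       (λ { refl → refl , refl , refl , refl , refl , refl })
       (l ℕ.≟ l′ ×-dec m ℕ.≟ m′ ×-dec a Bool.≟ a′ ×-dec b Bool.≟ b′ ×-dec c Bool.≟ c′ ×-dec d Bool.≟ d′)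

shapeOf : List Sign → Shape
shapeOf w = shape (4 ⊓ length w) (2 ⊓ negCount w) (allPos w) (allNeg w) (negsThenPoss w) (possThenNegs w)

stepShape : Sign → Shape → Shape
stepShape pos (shape l m aP aN nP pN) = shape (4 ⊓ suc l) m           aP    false aP pN
stepShape neg (shape l m aP aN nP pN) = shape (4 ⊓ suc l) (2 ⊓ suc m) false aN    nP aN

m⊓suc[m⊓n]≡m⊓suc[n] : ∀ m n → m ⊓ suc (m ⊓ n) ≡ m ⊓ suc n
m⊓suc[m⊓n]≡m⊓suc[n] zero    n       = refl
m⊓suc[m⊓n]≡m⊓suc[n] (suc m) zero    = refl
m⊓suc[m⊓n]≡m⊓suc[n] (suc m) (suc n) = cong suc (m⊓suc[m⊓n]≡m⊓suc[n] m n)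

shapeOf-∷ : ∀ c w → shapeOf (c ∷ w) ≡ stepShape c (shapeOf w)
shapeOf-∷ pos w rewrite m⊓suc[m⊓n]≡m⊓suc[n] 4 (length w) = refl
shapeOf-∷ neg w rewrite m⊓suc[m⊓n]≡m⊓suc[n] 4 (length w) | m⊓suc[m⊓n]≡m⊓suc[n] 2 (negCount w) = refl

obstructedShape : Sign → Shape → Bool
obstructedShape pos sh = Shape.negCountCap sh ≡ᵇ 1
obstructedShape neg sh = Shape.isNegsThenPoss sh ∨ Shape.isPossThenNegs sh

obstructedShape-shapeOf : ∀ β w → obstructedShape β (shapeOf w) ≡ Obstructed β w
obstructedShape-shapeOf pos w = 2⊓m≡ᵇ1 (negCount w)
  where
  2⊓m≡ᵇ1 : ∀ m → (2 ⊓ m ≡ᵇ 1) ≡ (m ≡ᵇ 1)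
  2⊓m≡ᵇ1 0             = refl
  2⊓m≡ᵇ1 1             = refl
  2⊓m≡ᵇ1 (suc (suc m)) = refl
obstructedShape-shapeOf neg w = refl

target₁ target₂ : Point
target₁ = + 1 , + 1
target₂ = + 1 , + 2

record Summary : Set where
  constructor summary
  field
    wordShape     : Shape
    reach₁ reach₂ : List Point

_≟ˢ_ : DecidableEquality Summary
summary s r₁ r₂ ≟ˢ summary s′ r₁′ r₂′ =
  map′ (λ { (refl , refl , refl) → refl }) (λ { refl → refl , refl , refl })
       (s ≟ˢʰ s′ ×-dec List.≡-dec _≟ᴾ_ r₁ r₁′ ×-dec List.≡-dec _≟ᴾ_ r₂ r₂′)

open import Data.List.Membership.DecPropositional _≟ˢ_ using () renaming (_∈?_ to _∈ˢ?_; _∉?_ to _∉ˢ?_)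

summaryOf : List Sign → Summary
summaryOf w = summary (shapeOf w) (canReach w target₁) (canReach w target₂)

stepSummary : Sign → Summary → Summary
stepSummary c (summary sh r₁ r₂) = summary (stepShape c sh) (stepBack c r₁) (stepBack c r₂)

summaryOf-∷ : ∀ c w → summaryOf (c ∷ w) ≡ stepSummary c (summaryOf w)
summaryOf-∷ c w = cong (λ sh → summary sh (canReach (c ∷ w) target₁) (canReach (c ∷ w) target₂)) (shapeOf-∷ c w)

Accepting : Sign → Summary → Set
Accepting β (summary sh r₁ r₂) =
  Shape.lengthCap sh ≡ 4 → obstructedShape β sh ≡ false → twist β target₁ ∈ r₁ ⊎ twist β target₂ ∈ r₂

accepting? : ∀ β A → Dec (Accepting β A)
accepting? β (summary sh r₁ r₂) =
  Shape.lengthCap sh ℕ.≟ 4 →-dec obstructedShape β sh Bool.≟ false →-dec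
  (twist β target₁ ∈ᴾ? r₁ ⊎-dec twist β target₂ ∈ᴾ? r₂)

StepClosed : List Summary → Summary → Set
StepClosed As A = stepSummary pos A ∈ As × stepSummary neg A ∈ As

Certified : List Summary → Set
Certified As = summaryOf [] ∈ As × All (λ A → StepClosed As A × Accepting pos A × Accepting neg A) As

certified? : ∀ As → Dec (Certified As)
certified? As = summaryOf [] ∈ˢ? As ×-dec all? entry? As
  where
  entry? : ∀ A → Dec (StepClosed As A × Accepting pos A × Accepting neg A)
  entry? A = (stepSummary pos A ∈ˢ? As ×-dec stepSummary neg A ∈ˢ? As) ×-dec accepting? pos A ×-dec accepting? neg A

explore : ℕ → List Summary → List Summary → List Summary
explore zero    seen _          = seen
explore (suc k) seen []         = seen
explore (suc k) seen (A ∷ todo) = explore k (seen ++ new) (todo ++ new)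
  where
  new : List Summary
  new = deduplicate _≟ˢ_ (filter (_∉ˢ? seen) (stepSummary pos A ∷ stepSummary neg A ∷ []))

-- Opaque, so that the search and its verification (57 summaries) run only once, when
-- `certificate` itself is checked.
opaque
  reachableSummaries : List Summary
  reachableSummaries = explore 64 (summaryOf [] ∷ []) (summaryOf [] ∷ [])

  certificate : Certified reachableSummaries
  certificate = toWitness {a? = certified? reachableSummaries} _

summaryOf-∈ : ∀ w → summaryOf w ∈ reachableSummaries
summaryOf-∈ []      = proj₁ certificate
summaryOf-∈ (c ∷ w) =
  subst (_∈ reachableSummaries) (sym (summaryOf-∷ c w)) (stepClosed c (All.lookup (proj₂ certificate) (summaryOf-∈ w)))
  where
  stepClosed : ∀ c {A} → StepClosed reachableSummaries A × Accepting pos A × Accepting neg A →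
               stepSummary c A ∈ reachableSummaries
  stepClosed pos ((∈₊ , _) , _) = ∈₊
  stepClosed neg ((_ , ∈₋) , _) = ∈₋

unobstructed⇒closedWalk : ∀ β w → 4 ≤ length w → Obstructed β w ≡ false → ∃[ t ] Walk 5 w (twist β t) t
unobstructed⇒closedWalk β w 4≤∣w∣ unobstructed =
  [ (λ start∈ → target₁ , canReach-sound w start∈) , (λ start∈ → target₂ , canReach-sound w start∈) ]
    (accepting β (All.lookup (proj₂ certificate) (summaryOf-∈ w))
                 (ℕ.m≤n⇒m⊓n≡m 4≤∣w∣) (trans (obstructedShape-shapeOf β w) unobstructed))
  where
  accepting : ∀ β {A} → StepClosed reachableSummaries A × Accepting pos A × Accepting neg A → Accepting β A
  accepting pos (_ , acc₊ , _) = acc₊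
  accepting neg (_ , _ , acc₋) = acc₋

-- The Möbius ladder

module Ladder (n′ : ℕ) where

  n M : ℕ
  n = suc n′
  M = n′ ℕ.+ n

  chordTerm : (ℕ → Sign) → (ℕ → ℤ) → ℕ → ℤ
  chordTerm T Y k with k ℕ.<? n
  ... | yes _ = Y k
  ... | no  _ = - (⟦ T (k ℕ.∸ n) ⟧ * Y (k ℕ.∸ n))

  chordTerm-< : ∀ T Y {k} → k < n → chordTerm T Y k ≡ Y k
  chordTerm-< T Y {k} k<n with k ℕ.<? n
  ... | yes _   = refl
  ... | no  k≮n = ⊥-elim (k≮n k<n)

  chordTerm-+ : ∀ T Y j → chordTerm T Y (n ℕ.+ j) ≡ - (⟦ T j ⟧ * Y j)
  chordTerm-+ T Y j with (n ℕ.+ j) ℕ.<? n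
  ... | yes n+j<n = ⊥-elim (ℕ.m+n≮m n j n+j<n)
  ... | no  _     rewrite ℕ.m+n∸m≡n n j = refl

  inflow : (S T : ℕ → Sign) (X Y : ℕ → ℤ) → ℕ → ℤ
  inflow S T X Y k = X k - ⟦ S (cycPred M k) ⟧ * X (cycPred M k) + chordTerm T Y k

  lower⊎upper : ∀ {k} → k < n ℕ.+ n → k < n ⊎ ∃[ j ] j < n × k ≡ n ℕ.+ j
  lower⊎upper {k} k<2n with k ℕ.<? n
  ... | yes k<n = inj₁ k<n
  ... | no  k≮n = inj₂ (k ℕ.∸ n , ℕ.+-cancelˡ-< n _ _ (subst (_< n ℕ.+ n) (sym n+[k∸n]≡k) k<2n) , sym n+[k∸n]≡k)
    where n+[k∸n]≡k = ℕ.m+[n∸m]≡n (ℕ.≮⇒≥ k≮n)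

  module Switching (S T : ℕ → Sign) where

    π : ℕ → Sign
    π zero    = pos
    π (suc k) = π k · S k

    β : Sign
    β = π (n ℕ.+ n)

    rungSign : ℕ → Sign
    rungSign j = π j · π (n ℕ.+ j) · T j

    module _ (X Y V a : ℕ → ℤ)
             (X≡ : ∀ k → k < n ℕ.+ n → X k ≡ ⟦ π k ⟧ * V (suc k))
             (Y≡ : ∀ j → j < n → Y j ≡ ⟦ π j ⟧ * a j)
             (V₀≡ : V 0 ≡ ⟦ β ⟧ * V (n ℕ.+ n)) where

      switch-cycle : ∀ k → k < n ℕ.+ n → ⟦ π k ⟧ * (X k - ⟦ S (cycPred M k) ⟧ * X (cycPred M k)) ≡ V (suc k) - V k
      switch-cycle zero    k<2n = begin
        + 1 * (X 0 - ⟦ S M ⟧ * X M)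
          ≡⟨ ℤ.*-identityˡ _ ⟩
        X 0 - ⟦ S M ⟧ * X M
          ≡⟨ cong₂ (λ x y → x - ⟦ S M ⟧ * y) (X≡ 0 k<2n) (X≡ M (ℕ.n<1+n M)) ⟩
        + 1 * V 1 - ⟦ S M ⟧ * (⟦ π M ⟧ * V (suc M))
          ≡⟨ cong₂ _-_ (ℤ.*-identityˡ (V 1)) (⟦t⟧*⟦s⟧*i≡⟦s·t⟧*i (π M) (S M) _) ⟩
        V 1 - ⟦ β ⟧ * V (suc M)
          ≡⟨ cong (_-_ (V 1)) V₀≡ ⟨
        V 1 - V 0
          ∎
        where open ≡-Reasoning
      switch-cycle (suc k) k<2n = begin
        ⟦ π k · S k ⟧ * (X (suc k) - ⟦ S k ⟧ * X k)
          ≡⟨ *-distribˡ-- ⟦ π k · S k ⟧ (X (suc k)) (⟦ S k ⟧ * X k) ⟩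
        ⟦ π (suc k) ⟧ * X (suc k) - ⟦ π k · S k ⟧ * (⟦ S k ⟧ * X k)
          ≡⟨ cong₂ _-_ (cong (⟦ π (suc k) ⟧ *_) (X≡ (suc k) k<2n)) (⟦s·t⟧*⟦t⟧*i≡⟦s⟧*i (π k) (S k) (X k)) ⟩
        ⟦ π (suc k) ⟧ * (⟦ π (suc k) ⟧ * V (suc (suc k))) - ⟦ π k ⟧ * X k
          ≡⟨ cong₂ _-_ (⟦s⟧*⟦s⟧*i≡i (π (suc k)) _)
                       (trans (cong (⟦ π k ⟧ *_) (X≡ k (ℕ.<-trans (ℕ.n<1+n k) k<2n))) (⟦s⟧*⟦s⟧*i≡i (π k) _)) ⟩
        V (suc (suc k)) - V (suc k)
          ∎
        where
        open ≡-Reasoning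
        *-distribˡ-- : ∀ s x y → s * (x - y) ≡ s * x - s * y
        *-distribˡ-- = solve-∀

      switch-chord : ∀ k → k < n ℕ.+ n → ⟦ π k ⟧ * chordTerm T Y k ≡ chordTerm rungSign a k
      switch-chord k k<2n with lower⊎upper k<2n
      ... | inj₁ k<n = begin
        ⟦ π k ⟧ * chordTerm T Y k    ≡⟨ cong (⟦ π k ⟧ *_) (trans (chordTerm-< T Y k<n) (Y≡ k k<n)) ⟩
        ⟦ π k ⟧ * (⟦ π k ⟧ * a k)    ≡⟨ ⟦s⟧*⟦s⟧*i≡i (π k) (a k) ⟩
        a k                          ≡⟨ chordTerm-< rungSign a k<n ⟨
        chordTerm rungSign a k       ∎
        where open ≡-Reasoning
      ... | inj₂ (j , j<n , refl) = begin
        ⟦ π (n ℕ.+ j) ⟧ * chordTerm T Y (n ℕ.+ j)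
          ≡⟨ cong (⟦ π (n ℕ.+ j) ⟧ *_) (trans (chordTerm-+ T Y j) (cong (λ y → - (⟦ T j ⟧ * y)) (Y≡ j j<n))) ⟩
        ⟦ π (n ℕ.+ j) ⟧ * - (⟦ T j ⟧ * (⟦ π j ⟧ * a j))
          ≡⟨ rearrange (π j) (π (n ℕ.+ j)) (T j) (a j) ⟩
        - (⟦ rungSign j ⟧ * a j)
          ≡⟨ chordTerm-+ rungSign a j ⟨
        chordTerm rungSign a (n ℕ.+ j)
          ∎
        where
        open ≡-Reasoning
        rearrange : ∀ p q t x → ⟦ q ⟧ * - (⟦ t ⟧ * (⟦ p ⟧ * x)) ≡ - (⟦ p · q · t ⟧ * x)
        rearrange p q t x rewrite ⟦·⟧ (p · q) t | ⟦·⟧ p q = ring ⟦ p ⟧ ⟦ q ⟧ ⟦ t ⟧ x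
          where
          ring : ∀ p q t x → q * - (t * (p * x)) ≡ - (p * q * t * x)
          ring = solve-∀

      switch : ∀ k → k < n ℕ.+ n → ⟦ π k ⟧ * inflow S T X Y k ≡ V (suc k) - V k + chordTerm rungSign a k
      switch k k<2n = trans (ℤ.*-distribˡ-+ ⟦ π k ⟧ _ (chordTerm T Y k))
                            (cong₂ _+_ (switch-cycle k k<2n) (switch-chord k k<2n))

  module _ (σ : Fin ((n ℕ.+ n) ℕ.+ n) → Sign) where

    G : SignedGraph
    G = MobiusLadder n σ

    cycleEdge : Fin (n ℕ.+ n) → Fin (nE G)
    cycleEdge i = i ↑ˡ n

    chordEdge : Fin n → Fin (nE G)
    chordEdge j = (n ℕ.+ n) ↑ʳ j

    cycleSign chordSign : ℕ → Sign
    cycleSign = atℕ pos (σ ∘ cycleEdge)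
    chordSign = atℕ pos (σ ∘ chordEdge)

    ends-cycleEdge : ∀ i → ends G (cycleEdge i) ≡ (i , cycSuc i)
    ends-cycleEdge i rewrite Fin.splitAt-↑ˡ (n ℕ.+ n) i n = refl

    ends-chordEdge : ∀ j → ends G (chordEdge j) ≡ (j ↑ˡ n , n ↑ʳ j)
    ends-chordEdge j rewrite Fin.splitAt-↑ʳ (n ℕ.+ n) n j = refl

    module _ (o : Orientation G) (f : Fin (nE G) → ℤ) where

      d₁ d₂ : Fin (nE G) → Dir
      d₁ e = proj₁ (dir o e)
      d₂ e = proj₂ (dir o e)

      in₁ in₂ : Fin (nE G) → ℤ
      in₁ e = inward (d₁ e) (f e)
      in₂ e = inward (d₂ e) (f e)

      in₂≡ : ∀ e → in₂ e ≡ - (⟦ σ e ⟧ * in₁ e)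
      in₂≡ e = inward-compatible (σ e) (d₁ e) (d₂ e) (f e) (compatible o e)

      cycleValue chordValue : ℕ → ℤ
      cycleValue = atℕ 0ℤ (in₁ ∘ cycleEdge)
      chordValue = atℕ 0ℤ (in₁ ∘ chordEdge)

      cycleEdges-inflow : ∀ v → sumFin (edgeInflow G o f v ∘ cycleEdge) ≡ in₁ (cycleEdge v) + in₂ (cycleEdge (cpred v))
      cycleEdges-inflow v = trans (sumFin-edgeInflow G o f cycleEdge (λ i → i) cycSuc v ends-cycleEdge) (cong₂ _+_
        (sumFin-halfInflow-hit (λ i → i) v (d₁ ∘ cycleEdge) (f ∘ cycleEdge) v refl (λ _ i≡v → i≡v))
        (sumFin-halfInflow-hit cycSuc v (d₂ ∘ cycleEdge) (f ∘ cycleEdge) (cpred v) (cycSuc-cpred v)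
                               (λ i → cycSuc≡⇒≡cpred i v)))

      chordInflow : ℕ → ℤ
      chordInflow = chordTerm chordSign chordValue

      chordEdges-inflow-↑ˡ : ∀ j → sumFin (edgeInflow G o f (j ↑ˡ n) ∘ chordEdge) ≡ chordInflow (toℕ (j ↑ˡ n))
      chordEdges-inflow-↑ˡ j = begin
        sumFin (edgeInflow G o f (j ↑ˡ n) ∘ chordEdge)
          ≡⟨ trans (sumFin-edgeInflow G o f chordEdge (_↑ˡ n) (n ↑ʳ_) (j ↑ˡ n) ends-chordEdge) $
             cong₂ _+_ (sumFin-halfInflow-hit (_↑ˡ n) (j ↑ˡ n) (d₁ ∘ chordEdge) (f ∘ chordEdge) j refl
                                              (λ i → Fin.↑ˡ-injective n i j))
                       (sumFin-halfInflow-miss (n ↑ʳ_) (j ↑ˡ n) (d₂ ∘ chordEdge) (f ∘ chordEdge)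
                                               (λ i → ↑ˡ≢↑ʳ j i ∘ sym)) ⟩
        in₁ (chordEdge j) + 0ℤ             ≡⟨ ℤ.+-identityʳ _ ⟩
        in₁ (chordEdge j)                  ≡⟨ atℕ-toℕ 0ℤ (in₁ ∘ chordEdge) j ⟨
        chordValue (toℕ j)                 ≡⟨ cong chordValue (Fin.toℕ-↑ˡ j n) ⟨
        chordValue (toℕ (j ↑ˡ n))          ≡⟨ chordTerm-< chordSign chordValue lower ⟨
        chordInflow (toℕ (j ↑ˡ n))         ∎
        where
        open ≡-Reasoning
        lower : toℕ (j ↑ˡ n) < n
        lower = subst (_< n) (sym (Fin.toℕ-↑ˡ j n)) (Fin.toℕ<n j)

      chordEdges-inflow-↑ʳ : ∀ j → sumFin (edgeInflow G o f (n ↑ʳ j) ∘ chordEdge) ≡ chordInflow (toℕ (n ↑ʳ j))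
      chordEdges-inflow-↑ʳ j = begin
        sumFin (edgeInflow G o f (n ↑ʳ j) ∘ chordEdge)
          ≡⟨ trans (sumFin-edgeInflow G o f chordEdge (_↑ˡ n) (n ↑ʳ_) (n ↑ʳ j) ends-chordEdge) $
             cong₂ _+_ (sumFin-halfInflow-miss (_↑ˡ n) (n ↑ʳ j) (d₁ ∘ chordEdge) (f ∘ chordEdge) (λ i → ↑ˡ≢↑ʳ i j))
                       (sumFin-halfInflow-hit (n ↑ʳ_) (n ↑ʳ j) (d₂ ∘ chordEdge) (f ∘ chordEdge) j refl
                                              (λ i → Fin.↑ʳ-injective n i j)) ⟩
        0ℤ + in₂ (chordEdge j)                            ≡⟨ ℤ.+-identityˡ _ ⟩
        in₂ (chordEdge j)                                 ≡⟨ in₂≡ (chordEdge j) ⟩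
        - (⟦ σ (chordEdge j) ⟧ * in₁ (chordEdge j))
          ≡⟨ cong₂ (λ s y → - (⟦ s ⟧ * y)) (atℕ-toℕ pos (σ ∘ chordEdge) j) (atℕ-toℕ 0ℤ (in₁ ∘ chordEdge) j) ⟨
        - (⟦ chordSign (toℕ j) ⟧ * chordValue (toℕ j))    ≡⟨ chordTerm-+ chordSign chordValue (toℕ j) ⟨
        chordInflow (n ℕ.+ toℕ j)                         ≡⟨ cong chordInflow (Fin.toℕ-↑ʳ n j) ⟨
        chordInflow (toℕ (n ↑ʳ j))                        ∎
        where open ≡-Reasoning

      chordEdges-inflow : ∀ v → sumFin (edgeInflow G o f v ∘ chordEdge) ≡ chordInflow (toℕ v)
      chordEdges-inflow v with splitAt n v in v≡
      ... | inj₁ j = subst P (Fin.splitAt⁻¹-↑ˡ v≡) (chordEdges-inflow-↑ˡ j)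
        where P = λ v → sumFin (edgeInflow G o f v ∘ chordEdge) ≡ chordInflow (toℕ v)
      ... | inj₂ j = subst P (Fin.splitAt⁻¹-↑ʳ v≡) (chordEdges-inflow-↑ʳ j)
        where P = λ v → sumFin (edgeInflow G o f v ∘ chordEdge) ≡ chordInflow (toℕ v)

      netInflow-ladder : ∀ v → netInflow G o f v ≡ inflow cycleSign chordSign cycleValue chordValue (toℕ v)
      netInflow-ladder v = begin
        netInflow G o f v
          ≡⟨ netInflow-edges G o f v ⟩
        sumFin (edgeInflow G o f v)
          ≡⟨ sumFin-↑ {n ℕ.+ n} (edgeInflow G o f v) ⟩
        sumFin (edgeInflow G o f v ∘ cycleEdge) + sumFin (edgeInflow G o f v ∘ chordEdge)
          ≡⟨ cong₂ _+_ (cycleEdges-inflow v) (chordEdges-inflow v) ⟩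
        in₁ (cycleEdge v) + in₂ (cycleEdge (cpred v)) + chordInflow (toℕ v)
          ≡⟨ cong (λ x → in₁ (cycleEdge v) + x + chordInflow (toℕ v)) (in₂≡ (cycleEdge (cpred v))) ⟩
        in₁ (cycleEdge v) - ⟦ σ (cycleEdge (cpred v)) ⟧ * in₁ (cycleEdge (cpred v)) + chordInflow (toℕ v)
          ≡⟨ cong₂ (λ x t → x - t + chordInflow (toℕ v))
                   (atℕ-toℕ 0ℤ (in₁ ∘ cycleEdge) v)
                   (cong₂ (λ s y → ⟦ s ⟧ * y)
                          (trans (cong cycleSign (sym (toℕ-cpred v))) (atℕ-toℕ pos (σ ∘ cycleEdge) (cpred v)))
                          (trans (cong cycleValue (sym (toℕ-cpred v))) (atℕ-toℕ 0ℤ (in₁ ∘ cycleEdge) (cpred v)))) ⟨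
        inflow cycleSign chordSign cycleValue chordValue (toℕ v)
          ∎
        where open ≡-Reasoning

    open Switching cycleSign chordSign

    rungWord : List Sign
    rungWord = applyUpTo rungSign n

    module FromFlow {k} (fl : NZFlow k G) where

      open NZFlow fl

      X Y V a : ℕ → ℤ
      X = cycleValue orient value
      Y = chordValue orient value
      -- so that V 0 ≡ ⟦ β ⟧ * V (n + n) holds by definition
      V zero    = ⟦ β ⟧ * (⟦ π M ⟧ * X M)
      V (suc i) = ⟦ π i ⟧ * X i
      a j = ⟦ π j ⟧ * Y j

      inflow≡0 : ∀ i → i < n ℕ.+ n → inflow cycleSign chordSign X Y i ≡ 0ℤ
      inflow≡0 i i<2n = begin
        inflow cycleSign chordSign X Y i                      ≡⟨ cong (inflow cycleSign chordSign X Y) (Fin.toℕ-fromℕ< i<2n) ⟨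
        inflow cycleSign chordSign X Y (toℕ (fromℕ< i<2n))    ≡⟨ netInflow-ladder orient value (fromℕ< i<2n) ⟨
        netInflow G orient value (fromℕ< i<2n)                ≡⟨ ℤ.i≡j⇒i-j≡0 (conserve (fromℕ< i<2n)) ⟩
        0ℤ                                                    ∎
        where open ≡-Reasoning

      ladder : ∀ i → i < n ℕ.+ n → V (suc i) - V i + chordTerm rungSign a i ≡ 0ℤ
      ladder i i<2n = begin
        V (suc i) - V i + chordTerm rungSign a i      ≡⟨ switch X Y V a X≡ Y≡ refl i i<2n ⟨
        ⟦ π i ⟧ * inflow cycleSign chordSign X Y i    ≡⟨ cong (⟦ π i ⟧ *_) (inflow≡0 i i<2n) ⟩
        ⟦ π i ⟧ * 0ℤ                                  ≡⟨ ℤ.*-zeroʳ ⟦ π i ⟧ ⟩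
        0ℤ                                            ∎
        where
        open ≡-Reasoning
        X≡ : ∀ i → i < n ℕ.+ n → X i ≡ ⟦ π i ⟧ * V (suc i)
        X≡ i _ = sym (⟦s⟧*⟦s⟧*i≡i (π i) (X i))
        Y≡ : ∀ j → j < n → Y j ≡ ⟦ π j ⟧ * a j
        Y≡ j _ = sym (⟦s⟧*⟦s⟧*i≡i (π j) (Y j))

      in₁-flowValue : ∀ e → FlowValue k (in₁ orient value e)
      in₁-flowValue e = flowValue-inward (d₁ orient value e) (nonzero e , bounded e)

      X-flowValue : ∀ i → i < n ℕ.+ n → FlowValue k (X i)
      X-flowValue i i<2n = subst (FlowValue k) (sym (atℕ-fromℕ< 0ℤ _ i<2n)) (in₁-flowValue _)

      a-flowValue : ∀ j → j < n → FlowValue k (a j)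
      a-flowValue j j<n = flowValue-⟦s⟧* (π j) (subst (FlowValue k) (sym (atℕ-fromℕ< 0ℤ _ j<n)) (in₁-flowValue _))

      V-flowValue : ∀ i → i ≤ n ℕ.+ n → FlowValue k (V i)
      V-flowValue zero    _    = flowValue-⟦s⟧* β (flowValue-⟦s⟧* (π M) (X-flowValue M (ℕ.n<1+n M)))
      V-flowValue (suc i) i<2n = flowValue-⟦s⟧* (π i) (X-flowValue i i<2n)

      R : ℕ → Point
      R j = V j , V (n ℕ.+ j)

      isPath : IsPath k rungSign n R
      isPath = record { valid = valid ; steps = steps }
        where
        valid : ∀ j → j ≤ n → FlowPoint k (R j)
        valid j j≤n = V-flowValue j (ℕ.≤-trans j≤n (ℕ.m≤m+n n n)) , V-flowValue (n ℕ.+ j) (ℕ.+-monoʳ-≤ n j≤n)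
        steps : ∀ j → j < n → Step k (rungSign j) (R j) (R (suc j))
        steps j j<n = subst (Step k (rungSign j) (R j)) (cong (V (suc j) ,_) (cong V (sym (ℕ.+-suc n j))))
          (step-from-equations (rungSign j) (a j) (a-flowValue j j<n)
            (trans (cong (_+_ (V (suc j) - V j)) (sym (chordTerm-< rungSign a j<n)))
                   (ladder j (ℕ.<-≤-trans j<n (ℕ.m≤m+n n n))))
            (trans (cong (_+_ (V (suc (n ℕ.+ j)) - V (n ℕ.+ j))) (sym (chordTerm-+ rungSign a j)))
                   (ladder (n ℕ.+ j) (ℕ.+-monoʳ-< n j<n))))

      closedWalk : Walk k rungWord (twist β (R n)) (R n)
      closedWalk = subst (λ s → Walk k rungWord s (R n)) (cong (V 0 ,_) (cong V (ℕ.+-identityʳ n)))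
                         (path⇒walk rungSign n R isPath)

    secondHalf : Sign → Dir
    secondHalf pos = away
    secondHalf neg = towards

    towardsFirst : Orientation G
    towardsFirst = record { dir = λ e → towards , secondHalf (σ e) ; compatible = compatible-towards ∘ σ }
      where
      compatible-towards : ∀ s → Compatible s (towards , secondHalf s)
      compatible-towards pos = λ ()
      compatible-towards neg = refl

    module FromPath (t : Point) {R : ℕ → Point} (R₀ : R 0 ≡ twist β t) (Rₙ : R n ≡ t) (path : IsPath 5 rungSign n R) where

      open IsPath path

      V : ℕ → ℤ
      V i with i ℕ.<? n
      ... | yes _ = proj₁ (R i)
      ... | no  _ = proj₂ (R (i ℕ.∸ n))

      V-< : ∀ {i} → i < n → V i ≡ proj₁ (R i)
      V-< {i} i<n with i ℕ.<? n
      ... | yes _   = refl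
      ... | no  i≮n = ⊥-elim (i≮n i<n)

      V-+ : ∀ j → V (n ℕ.+ j) ≡ proj₂ (R j)
      V-+ j with (n ℕ.+ j) ℕ.<? n
      ... | yes n+j<n = ⊥-elim (ℕ.m+n≮m n j n+j<n)
      ... | no  _     = cong (proj₂ ∘ R) (ℕ.m+n∸m≡n n j)

      V-≤ : ∀ {i} → i ≤ n → V i ≡ proj₁ (R i)
      V-≤ {i} i≤n with ℕ.m≤n⇒m<n∨m≡n i≤n
      ... | inj₁ i<n  = V-< i<n
      ... | inj₂ refl = begin
        V n            ≡⟨ cong V (ℕ.+-identityʳ n) ⟨
        V (n ℕ.+ 0)    ≡⟨ V-+ 0 ⟩
        proj₂ (R 0)    ≡⟨ cong proj₂ R₀ ⟩
        proj₁ t        ≡⟨ cong proj₁ Rₙ ⟨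
        proj₁ (R n)    ∎
        where open ≡-Reasoning

      V₀ : V 0 ≡ ⟦ β ⟧ * V (n ℕ.+ n)
      V₀ = begin
        V 0                    ≡⟨ V-< (s≤s z≤n) ⟩
        proj₁ (R 0)            ≡⟨ cong proj₁ R₀ ⟩
        ⟦ β ⟧ * proj₂ t        ≡⟨ cong (λ r → ⟦ β ⟧ * proj₂ r) Rₙ ⟨
        ⟦ β ⟧ * proj₂ (R n)    ≡⟨ cong (⟦ β ⟧ *_) (V-+ n) ⟨
        ⟦ β ⟧ * V (n ℕ.+ n)    ∎
        where open ≡-Reasoning

      V-flowValue : ∀ i → i ≤ n ℕ.+ n → FlowValue 5 (V i)
      V-flowValue i i≤2n with i ℕ.<? n
      ... | yes i<n = proj₁ (valid i (ℕ.<⇒≤ i<n))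
      ... | no  i≮n = proj₂ (valid (i ℕ.∸ n) (ℕ.+-cancelˡ-≤ n _ _ n+[i∸n]≤n+n))
        where n+[i∸n]≤n+n = subst (_≤ n ℕ.+ n) (sym (ℕ.m+[n∸m]≡n (ℕ.≮⇒≥ i≮n))) i≤2n

      a : ℕ → ℤ
      a j = proj₁ (R j) - proj₁ (R (suc j))

      ladder : ∀ i → i < n ℕ.+ n → V (suc i) - V i + chordTerm rungSign a i ≡ 0ℤ
      ladder i i<2n with lower⊎upper i<2n
      ... | inj₁ i<n rewrite V-≤ i<n | V-< i<n | chordTerm-< rungSign a i<n = ring (proj₁ (R (suc i))) (proj₁ (R i))
        where
        ring : ∀ p′ p → p′ - p + (p - p′) ≡ 0ℤ
        ring = solve-∀
      ... | inj₂ (j , j<n , refl) =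
        trans (cong₂ _+_ (cong₂ _-_ (trans (cong V (sym (ℕ.+-suc n j))) (V-+ (suc j))) (V-+ j)) (chordTerm-+ rungSign a j))
              (step-equation (steps j j<n))

      X Y : ℕ → ℤ
      X i = ⟦ π i ⟧ * V (suc i)
      Y j = ⟦ π j ⟧ * a j

      edgeValue : Fin (nE G) → ℤ
      edgeValue e = [ X ∘ toℕ , Y ∘ toℕ ] (splitAt (n ℕ.+ n) e)

      edgeValue-flowValue : ∀ e → FlowValue 5 (edgeValue e)
      edgeValue-flowValue e with splitAt (n ℕ.+ n) e
      ... | inj₁ i = flowValue-⟦s⟧* (π (toℕ i)) (V-flowValue (suc (toℕ i)) (Fin.toℕ<n i))
      ... | inj₂ j = flowValue-⟦s⟧* (π (toℕ j)) (step-value (steps (toℕ j) (Fin.toℕ<n j)))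

      cycleValue≡X : ∀ i → i < n ℕ.+ n → cycleValue towardsFirst edgeValue i ≡ X i
      cycleValue≡X i i<2n = begin
        cycleValue towardsFirst edgeValue i    ≡⟨ atℕ-fromℕ< 0ℤ (edgeValue ∘ cycleEdge) i<2n ⟩
        edgeValue (cycleEdge (fromℕ< i<2n))
          ≡⟨ cong [ X ∘ toℕ , Y ∘ toℕ ] (Fin.splitAt-↑ˡ (n ℕ.+ n) (fromℕ< i<2n) n) ⟩
        X (toℕ (fromℕ< i<2n))                  ≡⟨ cong X (Fin.toℕ-fromℕ< i<2n) ⟩
        X i                                    ∎
        where open ≡-Reasoning

      chordValue≡Y : ∀ j → j < n → chordValue towardsFirst edgeValue j ≡ Y j
      chordValue≡Y j j<n = begin
        chordValue towardsFirst edgeValue j    ≡⟨ atℕ-fromℕ< 0ℤ (edgeValue ∘ chordEdge) j<n ⟩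
        edgeValue (chordEdge (fromℕ< j<n))
          ≡⟨ cong [ X ∘ toℕ , Y ∘ toℕ ] (Fin.splitAt-↑ʳ (n ℕ.+ n) n (fromℕ< j<n)) ⟩
        Y (toℕ (fromℕ< j<n))                   ≡⟨ cong Y (Fin.toℕ-fromℕ< j<n) ⟩
        Y j                                    ∎
        where open ≡-Reasoning

      conserved : ∀ v → netInflow G towardsFirst edgeValue v ≡ 0ℤ
      conserved v = begin
        netInflow G towardsFirst edgeValue v
          ≡⟨ netInflow-ladder towardsFirst edgeValue v ⟩
        inflow cycleSign chordSign (cycleValue towardsFirst edgeValue) (chordValue towardsFirst edgeValue) (toℕ v)
          ≡⟨ ⟦s⟧*i≡0⇒i≡0 (π (toℕ v)) (trans (switch _ _ V a cycleValue≡X chordValue≡Y V₀ (toℕ v) (Fin.toℕ<n v))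
                                            (ladder (toℕ v) (Fin.toℕ<n v))) ⟩
        0ℤ
          ∎
        where open ≡-Reasoning

      flow : NZFlow 5 G
      flow = record
        { orient   = towardsFirst
        ; value    = edgeValue
        ; nonzero  = proj₁ ∘ edgeValue-flowValue
        ; bounded  = proj₂ ∘ edgeValue-flowValue
        ; conserve = λ v → ℤ.i-j≡0⇒i≡j _ _ (conserved v)
        }

    fiveFlow : 4 ≤ n → FlowAdmissible G → NZFlow 5 G
    fiveFlow 4≤n (k , fl) with Obstructed β rungWord in obstructed
    ... | true  = ⊥-elim (closedWalk⇒¬Obstructed β rungWord _ (FromFlow.closedWalk fl) (subst T (sym obstructed) _))
    ... | false =
      let t , closed          = unobstructed⇒closedWalk β rungWord 4≤∣rungWord∣ obstructed
          R , R₀ , Rₙ , path  = walk⇒path rungSign n closed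
      in  FromPath.flow t R₀ Rₙ path
      where
      4≤∣rungWord∣ : 4 ≤ length rungWord
      4≤∣rungWord∣ = subst (4 ≤_) (sym (List.length-applyUpTo rungSign n)) 4≤n

mainTheorem8 : (n : ℕ) → 4 ≤ n → (σ : Fin ((n ℕ.+ n) ℕ.+ n) → Sign) →
    FlowAdmissible (MobiusLadder n σ) → NZFlow 5 (MobiusLadder n σ)
mainTheorem8 (suc n′) 4≤n σ = Ladder.fiveFlow n′ σ 4≤n
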